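{- Let $G=(V,A)$ be a directed multigraph, let $A_1,A_2$ be an arbitrary arc split of $G$, and let $s,t\in V$. Then every set $M\subseteq A$ that is split-covering with respect to $A_1,A_2$ and $s,t$ is an $s$-$t$ cut in $G$. Moreover, there exists an $s$-$t$ min-cut in $G$ that is split-covering with respect to $A_1,A_2$ and $s,t$.
   Context: Arcs have unit capacities; parallel arcs are allowed and each arc has its own identity. For vertices $x,y$ and a subgraph $H$, a set $M$ of arcs is an $x$-$y$ cut in $H$ if $y$ is not reachable from $x$ in $H\setminus M$; a min-cut is a cut of minimum cardinality. Source side $S_M$: vertices reachable from $x$ in $H\setminus M$; target side $T_M$: vertices from which $y$ is reachable in $H\setminus M$. $M$ is strictly later than $M'$ ($M>M'$) iff $T_M\subsetneq T_{M'}$, and strictly earlier ($M<M'$) iff $S_M\subsetneq S_{M'}$. An $x$-$y$ cut $M$ is $x$-$y$-latest (resp. $x$-$y$-earliest) in $H$ iff there is no $x$-$y$ cut $M''$ in $H$ with $M''>M$ (resp. $M''<M$) and $|M''|\le|M|$. An arc split of $G=(V,A)$ is a partition $A=A_1\cup A_2$ such that there are no vertices $x,y,z$ with $(x,y)\in A_2$ and $(y,z)\in A_1$. A set $M\subseteq A$ is split-covering with respect to $A_1,A_2$ and $s,t$ iff for every $v\in V$ there exists $M_v\subseteq M$ such that at least one of the following holds: (i) $s\ne v\ne t$ and $v$ is either unreachable from $s$ in $(V,A_1)$ or $v$ does not reach $t$ in $(V,A_2)$; (ii) $M_v$ is an $s$-$v$-earliest cut in $(V,A_1)$; (iii) $M_v$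 is a $v$-$t$-latest cut in $(V,A_2)$. -}

module Defs where

open import Data.Nat using (ℕ; _≤_)
open import Data.Fin using (Fin)
open import Data.Fin.Subset using (Subset; _∈_; _∉_; _⊆_; ∣_∣; ⊤; ⊥)
open import Data.Product using (Σ; ∃; _×_; _,_)
open import Data.Sum using (_⊎_)
open import Relation.Nullary using (¬_)
open import Relation.Binary.PropositionalEquality using (_≡_; _≢_)

-- A directed multigraph: vertices Fin n, arcs Fin m (each arc has its own
-- identity, parallel arcs allowed), each arc a goes from src a to tgt a.
record MultiDigraph : Set where
  field
    n   : ℕ
    m   : ℕ
    src : Fin m → Fin n
    tgt : Fin m → Fin n

open MultiDigraph public

Vtx : MultiDigraph → Set
Vtx G = Fin (n G)

ArcSet : MultiDigraph → Set
ArcSet G = Subset (m G)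

data Reach (G : MultiDigraph) (H M : ArcSet G) : Vtx G → Vtx G → Set where
  here : ∀ {x} → Reach G H M x x
  step : ∀ {y} (a : Fin (m G)) → a ∈ H → a ∉ M →
         Reach G H M (tgt G a) y → Reach G H M (src G a) y

Cut : (G : MultiDigraph) → ArcSet G → Vtx G → Vtx G → ArcSet G → Set
Cut G H x y M = M ⊆ H × ¬ Reach G H M x y

SourceSide : (G : MultiDigraph) → ArcSet G → Vtx G → ArcSet G → Vtx G → Set
SourceSide G H x M v = Reach G H M x v

TargetSide : (G : MultiDigraph) → ArcSet G → Vtx G → ArcSet G → Vtx G → Set
TargetSide G H y M v = Reach G H M v y

_⊂ᵥ_ : {G : MultiDigraph} → (Vtx G → Set) → (Vtx G → Set) → Set
_⊂ᵥ_ {G} P Q = (∀ v → P v → Q v) × (∃ λ v → Q v × ¬ P v)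

StrictlyLater : (G : MultiDigraph) → ArcSet G → Vtx G → Vtx G → ArcSet G → ArcSet G → Set
StrictlyLater G H x y M'' M = _⊂ᵥ_ {G} (TargetSide G H y M'') (TargetSide G H y M)

StrictlyEarlier : (G : MultiDigraph) → ArcSet G → Vtx G → Vtx G → ArcSet G → ArcSet G → Set
StrictlyEarlier G H x y M'' M = _⊂ᵥ_ {G} (SourceSide G H x M'') (SourceSide G H x M)

Latest : (G : MultiDigraph) → ArcSet G → Vtx G → Vtx G → ArcSet G → Set
Latest G H x y M =
  Cut G H x y M ×
  ¬ (∃ λ M'' → Cut G H x y M'' × StrictlyLater G H x y M'' M × ∣ M'' ∣ ≤ ∣ M ∣)

Earliest : (G : MultiDigraph) → ArcSet G → Vtx G → Vtx G → ArcSet G → Set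
Earliest G H x y M =
  Cut G H x y M ×
  ¬ (∃ λ M'' → Cut G H x y M'' × StrictlyEarlier G H x y M'' M × ∣ M'' ∣ ≤ ∣ M ∣)

MinCut : (G : MultiDigraph) → ArcSet G → Vtx G → Vtx G → ArcSet G → Set
MinCut G H x y M = Cut G H x y M × (∀ M' → Cut G H x y M' → ∣ M ∣ ≤ ∣ M' ∣)

IsPartition : (G : MultiDigraph) → ArcSet G → ArcSet G → Set
IsPartition G A₁ A₂ = ∀ a → (a ∈ A₁ × a ∉ A₂) ⊎ (a ∉ A₁ × a ∈ A₂)

ArcSplit : (G : MultiDigraph) → ArcSet G → ArcSet G → Set
ArcSplit G A₁ A₂ =
  IsPartition G A₁ A₂ ×
  ¬ (∃ λ a → ∃ λ b → a ∈ A₂ × b ∈ A₁ × tgt G a ≡ src G b)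

SplitCovering : (G : MultiDigraph) → ArcSet G → ArcSet G → Vtx G → Vtx G → ArcSet G → Set
SplitCovering G A₁ A₂ s t M =
  ∀ v → ∃ λ Mᵥ → Mᵥ ⊆ M ×
    ((s ≢ v × v ≢ t × (¬ Reach G A₁ ⊥ s v ⊎ ¬ Reach G A₂ ⊥ v t))
     ⊎ Earliest G A₁ s v Mᵥ
     ⊎ Latest G A₂ v t Mᵥ)

-- Along any s-t path of G the arcs of A₁ all come before the arcs of A₂, so the path
-- crosses from A₁ to A₂ at a single vertex w; a split-covering set contains a cut of the
-- A₁-prefix or of the A₂-suffix at w. For the converse take, among the s-t min-cuts, one
-- minimising |R| + |Q|, where R is the set of vertices reachable from s by A₁-arcs and Q
-- the set of vertices reaching t by A₂-arcs. The A₁-arcs leaving R form an earliest cut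
-- for every vertex outside R, and the A₂-arcs entering Q a latest cut for every vertex
-- outside Q; every vertex lies outside R or outside Q. If a smaller or equal, strictly
-- earlier (later) cut existed, exchanging it for those arcs would give an s-t cut that is
-- no larger and has smaller |R| + |Q|.
module Submission where

open import Defs

open import Data.Empty using (⊥-elim)
open import Data.Fin using (Fin; _≟_)
open import Data.Fin.Properties using (any?)
open import Data.Fin.Subset
  using (Subset; inside; outside; ⊤; _∈_; _∉_; _⊆_; _─_; _∪_; _-_; ⁅_⁆; ∣_∣)
open import Data.Fin.Subset.Properties
  using ( _∈?_; ∈⊤; ⊆-min; ∣p∣≤∣x∷p∣; p⊆q⇒∣p∣≤∣q∣; p⊂q⇒∣p∣<∣q∣; p⊆p∪q; q⊆p∪q; p─q⊆p
        ; drop-∷-⊆; x∈p∧x∉q⇒x∈p─q; x∈p∧x≢y⇒x∈p-y; p─q─r≡p─r─q; x∈p⇒∣p-x∣<∣p∣; anySubset? )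
open import Data.Nat using (ℕ; zero; suc; _+_; _≤_; _<_; z≤n; s≤s; _≤?_; _<?_)
open import Data.Nat.Properties
  using ( ≤-refl; ≤-trans; ≤-reflexive; ≤-pred; <-≤-trans; <⇒≱; ≮⇒≥; +-suc
        ; +-monoʳ-≤; +-mono-<-≤; +-mono-≤-<; module ≤-Reasoning )
open import Data.Product using (∃; _×_; _,_; proj₁; proj₂)
open import Data.Sum using (_⊎_; inj₁; inj₂)
open import Data.Vec using (_∷_; []; tabulate; here)
open import Data.Vec.Properties using (lookup∘tabulate; []=⇒lookup; lookup⇒[]=)
open import Relation.Nullary using (¬_; Dec; yes; no; does)
open import Relation.Nullary.Decidable
  using (map′; _×-dec_; _⊎-dec_; ¬?; dec-true; decidable-stable)
open import Relation.Unary using (Pred; Decidable)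
open import Relation.Binary.PropositionalEquality using (_≡_; _≢_; refl; sym; trans; subst; cong)

⟦_⟧ : ∀ {k ℓ} {P : Pred (Fin k) ℓ} → Decidable P → Subset k
⟦ P? ⟧ = tabulate (λ x → does (P? x))

∈⟦⟧⁺ : ∀ {k ℓ} {P : Pred (Fin k) ℓ} (P? : Decidable P) {x} → P x → x ∈ ⟦ P? ⟧
∈⟦⟧⁺ P? {x} px = lookup⇒[]= x _ (trans (lookup∘tabulate _ x) (dec-true (P? x) px))

∈⟦⟧⁻ : ∀ {k ℓ} {P : Pred (Fin k) ℓ} (P? : Decidable P) {x} → x ∈ ⟦ P? ⟧ → P x
∈⟦⟧⁻ P? {x} x∈ with P? x | trans (sym (lookup∘tabulate (λ y → does (P? y)) x)) ([]=⇒lookup x∈)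
... | yes px | _ = px
... | no _   | ()

∣p∪q∣≤∣p∣+∣q∣ : ∀ {k} (p q : Subset k) → ∣ p ∪ q ∣ ≤ ∣ p ∣ + ∣ q ∣
∣p∪q∣≤∣p∣+∣q∣ []            []            = z≤n
∣p∪q∣≤∣p∣+∣q∣ (inside  ∷ p) (x ∷ q)       =
  s≤s (≤-trans (∣p∪q∣≤∣p∣+∣q∣ p q) (+-monoʳ-≤ ∣ p ∣ (∣p∣≤∣x∷p∣ x q)))
∣p∪q∣≤∣p∣+∣q∣ (outside ∷ p) (outside ∷ q) = ∣p∪q∣≤∣p∣+∣q∣ p q
∣p∪q∣≤∣p∣+∣q∣ (outside ∷ p) (inside  ∷ q) =
  ≤-trans (s≤s (∣p∪q∣≤∣p∣+∣q∣ p q)) (≤-reflexive (sym (+-suc ∣ p ∣ ∣ q ∣)))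

∣p─q∣+∣q∣≡∣p∣ : ∀ {k} {p q : Subset k} → q ⊆ p → ∣ p ─ q ∣ + ∣ q ∣ ≡ ∣ p ∣
∣p─q∣+∣q∣≡∣p∣ {p = []}          {[]}          _   = refl
∣p─q∣+∣q∣≡∣p∣ {p = inside  ∷ p} {outside ∷ q} q⊆p = cong suc (∣p─q∣+∣q∣≡∣p∣ (drop-∷-⊆ q⊆p))
∣p─q∣+∣q∣≡∣p∣ {p = outside ∷ p} {outside ∷ q} q⊆p = ∣p─q∣+∣q∣≡∣p∣ (drop-∷-⊆ q⊆p)
∣p─q∣+∣q∣≡∣p∣ {p = inside  ∷ p} {inside  ∷ q} q⊆p =
  trans (+-suc ∣ p ─ q ∣ ∣ q ∣) (cong suc (∣p─q∣+∣q∣≡∣p∣ (drop-∷-⊆ q⊆p)))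
∣p─q∣+∣q∣≡∣p∣ {p = outside ∷ p} {inside  ∷ q} q⊆p with q⊆p here
... | ()

∣p─q∪r∣≤∣p∣ : ∀ {k} {p q r : Subset k} → q ⊆ p → ∣ r ∣ ≤ ∣ q ∣ → ∣ (p ─ q) ∪ r ∣ ≤ ∣ p ∣
∣p─q∪r∣≤∣p∣ {p = p} {q} {r} q⊆p r≤q = begin
  ∣ (p ─ q) ∪ r ∣    ≤⟨ ∣p∪q∣≤∣p∣+∣q∣ (p ─ q) r ⟩
  ∣ p ─ q ∣ + ∣ r ∣  ≤⟨ +-monoʳ-≤ ∣ p ─ q ∣ r≤q ⟩
  ∣ p ─ q ∣ + ∣ q ∣  ≡⟨ ∣p─q∣+∣q∣≡∣p∣ q⊆p ⟩
  ∣ p ∣              ∎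
  where open ≤-Reasoning

module _ {k ℓ} {P : Pred (Subset k) ℓ} (P? : Decidable P) (f : Subset k → ℕ) where

  argmin-below : ∀ b M → P M → f M < b → ∃ λ M₀ → P M₀ × (∀ M' → P M' → f M₀ ≤ f M')
  argmin-below zero    M pM ()
  argmin-below (suc b) M pM fM<b with anySubset? (λ M' → P? M' ×-dec f M' <? f M)
  ... | yes (M' , pM' , fM'<fM) = argmin-below b M' pM' (<-≤-trans fM'<fM (≤-pred fM<b))
  ... | no  none                = M , pM , λ M' pM' → ≮⇒≥ (λ fM'<fM → none (M' , pM' , fM'<fM))

  argmin : ∃ P → ∃ λ M₀ → P M₀ × (∀ M' → P M' → f M₀ ≤ f M')
  argmin (M , pM) = argmin-below (suc (f M)) M pM ≤-refl

module _ {G : MultiDigraph} where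

  Reach-mono : ∀ {H N H' N' : ArcSet G} → (∀ {a} → a ∈ H → a ∉ N → a ∈ H' × a ∉ N') →
               ∀ {x y} → Reach G H N x y → Reach G H' N' x y
  Reach-mono usable here               = here
  Reach-mono usable (step a a∈H a∉N r) =
    step a (proj₁ (usable a∈H a∉N)) (proj₂ (usable a∈H a∉N)) (Reach-mono usable r)

  Reach-antimono : ∀ {H N N' : ArcSet G} → (∀ {a} → a ∈ H → a ∈ N → a ∈ N') →
                   ∀ {x y} → Reach G H N' x y → Reach G H N x y
  Reach-antimono N⊆N' = Reach-mono (λ a∈H a∉N' → a∈H , λ a∈N → a∉N' (N⊆N' a∈H a∈N))

  Reach-swapped-in : ∀ {H M D M'' : ArcSet G} {x y} →
                     Reach G H ((M ─ D) ∪ M'') x y → Reach G H M'' x y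
  Reach-swapped-in {M = M} {D} = Reach-antimono (λ _ → q⊆p∪q (M ─ D) _)

  Reach-swapped-elsewhere : ∀ {H M D M'' : ArcSet G} → (∀ {a} → a ∈ H → a ∉ D) →
                            ∀ {x y} → Reach G H ((M ─ D) ∪ M'') x y → Reach G H M x y
  Reach-swapped-elsewhere {M'' = M''} H∌D =
    Reach-antimono (λ a∈H a∈M → p⊆p∪q M'' (x∈p∧x∉q⇒x∈p─q a∈M (H∌D a∈H)))

  Reach-refl⊎first-arc : ∀ {H N : ArcSet G} {x y} → Reach G H N x y →
                         x ≡ y ⊎ ∃ λ a → a ∈ H × src G a ≡ x
  Reach-refl⊎first-arc here             = inj₁ refl
  Reach-refl⊎first-arc (step a a∈H _ _) = inj₂ (a , a∈H , refl)

  Reach-trans : ∀ {H N : ArcSet G} {x y z} → Reach G H N x y → Reach G H N y z → Reach G H N x z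
  Reach-trans here               r' = r'
  Reach-trans (step a a∈H a∉N r) r' = step a a∈H a∉N (Reach-trans r r')

  Reach-avoid⊎pass : ∀ {H N : ArcSet G} a {x y} → Reach G H N x y →
                     Reach G (H - a) N x y ⊎
                     (Reach G (H - a) N x (src G a) × Reach G (H - a) N (tgt G a) y)
  Reach-avoid⊎pass a here = inj₁ here
  Reach-avoid⊎pass a (step b b∈H b∉N r) with b ≟ a | Reach-avoid⊎pass a r
  ... | yes refl | inj₁ r'         = inj₂ (here , r')
  ... | yes refl | inj₂ (_ , r')   = inj₂ (here , r')
  ... | no  b≢a  | inj₁ r'         = inj₁ (step b (x∈p∧x≢y⇒x∈p-y b∈H b≢a) b∉N r')
  ... | no  b≢a  | inj₂ (r₁ , r₂)  = inj₂ (step b (x∈p∧x≢y⇒x∈p-y b∈H b≢a) b∉N r₁ , r₂)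

  Reach-no-arcs : ∀ {H N : ArcSet G} → ¬ (∃ λ a → a ∈ H × a ∉ N) →
                  ∀ {x y} → Reach G H N x y → x ≡ y
  Reach-no-arcs none here               = refl
  Reach-no-arcs none (step a a∈H a∉N _) = ⊥-elim (none (a , a∈H , a∉N))

  reach?-below : ∀ b (H N : ArcSet G) → ∣ H ─ N ∣ < b → ∀ x y → Dec (Reach G H N x y)
  reach?-below zero    H N ()      x y
  reach?-below (suc b) H N size<b x y with any? (λ a → a ∈? H ×-dec ¬? (a ∈? N))
  ... | no  none            = map′ (λ { refl → here }) (Reach-no-arcs none) (x ≟ y)
  ... | yes (a , a∈H , a∉N) =
    map′ through (Reach-avoid⊎pass a)
         (reach? x y ⊎-dec (reach? x (src G a) ×-dec reach? (tgt G a) y))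
    where
      shrinks : ∣ H - a ─ N ∣ < ∣ H ─ N ∣
      shrinks = subst (λ p → ∣ p ∣ < ∣ H ─ N ∣) (sym (p─q─r≡p─r─q H ⁅ a ⁆ N))
                      (x∈p⇒∣p-x∣<∣p∣ (x∈p∧x∉q⇒x∈p─q a∈H a∉N))

      reach? : ∀ x y → Dec (Reach G (H - a) N x y)
      reach? = reach?-below b (H - a) N (<-≤-trans shrinks (≤-pred size<b))

      restore : ∀ {x y} → Reach G (H - a) N x y → Reach G H N x y
      restore = Reach-mono (λ b∈H-a b∉N → p─q⊆p H ⁅ a ⁆ b∈H-a , b∉N)

      through : ∀ {x y} → Reach G (H - a) N x y ⊎
                (Reach G (H - a) N x (src G a) × Reach G (H - a) N (tgt G a) y) → Reach G H N x y
      through (inj₁ r)         = restore r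
      through (inj₂ (r₁ , r₂)) = Reach-trans (restore r₁) (step a a∈H a∉N (restore r₂))

  reach? : ∀ (H N : ArcSet G) x y → Dec (Reach G H N x y)
  reach? H N = reach?-below (suc ∣ H ─ N ∣) H N ≤-refl

module _ (G : MultiDigraph) (A₁ A₂ : ArcSet G) (s t : Vtx G) (split : ArcSplit G A₁ A₂) where

  A₁∌A₂ : ∀ {a} → a ∈ A₁ → a ∉ A₂
  A₁∌A₂ {a} a∈A₁ a∈A₂ with proj₁ split a
  ... | inj₁ (_ , a∉A₂) = a∉A₂ a∈A₂
  ... | inj₂ (a∉A₁ , _) = a∉A₁ a∈A₁

  Reach-split : ∀ {N : ArcSet G} {x y} → Reach G ⊤ N x y →
                ∃ λ w → Reach G A₁ N x w × Reach G A₂ N w y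
  Reach-split here = _ , here , here
  Reach-split (step a _ a∉N r) with Reach-split r | proj₁ split a
  ... | w , r₁ , r₂ | inj₁ (a∈A₁ , _) = w , step a a∈A₁ a∉N r₁ , r₂
  ... | w , r₁ , r₂ | inj₂ (_ , a∈A₂) with Reach-refl⊎first-arc r₁
  ...   | inj₁ refl                 = _ , here , step a a∈A₂ a∉N r₂
  ...   | inj₂ (b , b∈A₁ , src≡tgt) = ⊥-elim (proj₂ split (a , b , a∈A₂ , b∈A₁ , sym src≡tgt))

  split-covering⇒cut : ∀ M → SplitCovering G A₁ A₂ s t M → Cut G ⊤ s t M
  split-covering⇒cut M cover = (λ _ → ∈⊤) , λ r → crossing (Reach-split r)
    where
      crossing : ¬ ∃ λ w → Reach G A₁ M s w × Reach G A₂ M w t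
      crossing (w , r₁ , r₂) with cover w
      ... | _ , _    , inj₁ (_ , _ , inj₁ ¬r₁)       = ¬r₁ (Reach-antimono (λ _ → ⊆-min M) r₁)
      ... | _ , _    , inj₁ (_ , _ , inj₂ ¬r₂)       = ¬r₂ (Reach-antimono (λ _ → ⊆-min M) r₂)
      ... | _ , Mw⊆M , inj₂ (inj₁ ((_ , ¬r₁) , _)) = ¬r₁ (Reach-antimono (λ _ → Mw⊆M) r₁)
      ... | _ , Mw⊆M , inj₂ (inj₂ ((_ , ¬r₂) , _)) = ¬r₂ (Reach-antimono (λ _ → Mw⊆M) r₂)

  R Q : ArcSet G → Subset (n G)
  R N = ⟦ reach? {G} A₁ N s ⟧
  Q N = ⟦ (λ v → reach? {G} A₂ N v t) ⟧

  ∈R⁺ : ∀ {N v} → Reach G A₁ N s v → v ∈ R N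
  ∈R⁺ {N} = ∈⟦⟧⁺ (reach? {G} A₁ N s)

  ∈R⁻ : ∀ {N v} → v ∈ R N → Reach G A₁ N s v
  ∈R⁻ {N} = ∈⟦⟧⁻ (reach? {G} A₁ N s)

  ∈Q⁺ : ∀ {N v} → Reach G A₂ N v t → v ∈ Q N
  ∈Q⁺ {N} = ∈⟦⟧⁺ (λ v → reach? {G} A₂ N v t)

  ∈Q⁻ : ∀ {N v} → v ∈ Q N → Reach G A₂ N v t
  ∈Q⁻ {N} = ∈⟦⟧⁻ (λ v → reach? {G} A₂ N v t)

  weight : ArcSet G → ℕ
  weight N = ∣ R N ∣ + ∣ Q N ∣

  cut⇒R∌Q : ∀ {M w} → Cut G ⊤ s t M → w ∈ R M → w ∉ Q M
  cut⇒R∌Q (_ , ¬r) w∈R w∈Q = ¬r (Reach-trans (to⊤ (∈R⁻ w∈R)) (to⊤ (∈Q⁻ w∈Q)))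
    where
      to⊤ : ∀ {H N : ArcSet G} {x y} → Reach G H N x y → Reach G ⊤ N x y
      to⊤ = Reach-mono (λ _ a∉N → ∈⊤ , a∉N)

  cut-from-sides : ∀ {M M'} → Cut G ⊤ s t M → R M' ⊆ R M → Q M' ⊆ Q M → Cut G ⊤ s t M'
  cut-from-sides cut R⊆ Q⊆ = (λ _ → ∈⊤) , λ r →
    let w , r₁ , r₂ = Reach-split r in cut⇒R∌Q cut (R⊆ (∈R⁺ r₁)) (Q⊆ (∈Q⁺ r₂))

  cut? : Decidable (Cut G ⊤ s t)
  cut? M = map′ ((λ _ → ∈⊤) ,_) proj₂ (¬? (reach? {G} ⊤ M s t))

  ⊤-cut : s ≢ t → Cut G ⊤ s t ⊤
  ⊤-cut s≢t = (λ _ → ∈⊤) , λ r → s≢t (Reach-no-arcs (λ (_ , _ , a∉⊤) → a∉⊤ ∈⊤) r)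

  Lightest : ArcSet G → Set
  Lightest M = ∀ M' → Cut G ⊤ s t M' → ∣ M' ∣ ≤ ∣ M ∣ → weight M ≤ weight M'

  lightest-min-cut : s ≢ t → ∃ λ M → MinCut G ⊤ s t M × Lightest M
  lightest-min-cut s≢t with argmin cut? ∣_∣ (⊤ , ⊤-cut s≢t)
  ... | M₀ , cut₀ , min₀
    with argmin (λ M → cut? M ×-dec ∣ M ∣ ≤? ∣ M₀ ∣) weight (M₀ , cut₀ , ≤-refl)
  ... | M , (cut , M≤M₀) , least =
    M , (cut , λ M' cut' → ≤-trans M≤M₀ (min₀ M' cut')) ,
    λ M' cut' M'≤M → least M' (cut' , ≤-trans M'≤M M≤M₀)

  module _ {M} (cut : Cut G ⊤ s t M) (lightest : Lightest M) where

    exchange-not-lighter : ∀ {D M''} → D ⊆ M → ∣ M'' ∣ ≤ ∣ D ∣ →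
                           R ((M ─ D) ∪ M'') ⊆ R M → Q ((M ─ D) ∪ M'') ⊆ Q M →
                           ¬ weight ((M ─ D) ∪ M'') < weight M
    exchange-not-lighter D⊆M M''≤D R⊆ Q⊆ lighter =
      <⇒≱ lighter (lightest _ (cut-from-sides cut R⊆ Q⊆) (∣p─q∪r∣≤∣p∣ D⊆M M''≤D))

    exit? : Decidable (λ a → a ∈ A₁ × src G a ∈ R M × tgt G a ∉ R M)
    exit? a = a ∈? A₁ ×-dec (src G a ∈? R M ×-dec ¬? (tgt G a ∈? R M))

    exits : ArcSet G
    exits = ⟦ exit? ⟧

    exits⊆A₁ : exits ⊆ A₁
    exits⊆A₁ a∈exits = proj₁ (∈⟦⟧⁻ exit? a∈exits)

    exits⊆M : exits ⊆ M
    exits⊆M {a} a∈exits with ∈⟦⟧⁻ exit? a∈exits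
    ... | a∈A₁ , src∈R , tgt∉R = decidable-stable (a ∈? M)
      (λ a∉M → tgt∉R (∈R⁺ (Reach-trans (∈R⁻ src∈R) (step a a∈A₁ a∉M here))))

    R-closed : ∀ {x y} → Reach G A₁ exits x y → x ∈ R M → y ∈ R M
    R-closed here                    x∈R   = x∈R
    R-closed (step a a∈A₁ a∉exits r) src∈R = R-closed r (decidable-stable (tgt G a ∈? R M)
      (λ tgt∉R → a∉exits (∈⟦⟧⁺ exit? (a∈A₁ , src∈R , tgt∉R))))

    exits-earliest : ∀ v → v ∉ R M → Earliest G A₁ s v exits
    exits-earliest v v∉R = (exits⊆A₁ , λ r → v∉R (R-closed r (∈R⁺ here))) , no-earlier
      where
        no-earlier : ¬ ∃ λ M'' → Cut G A₁ s v M'' × StrictlyEarlier G A₁ s v M'' exits ×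
                                 ∣ M'' ∣ ≤ ∣ exits ∣
        no-earlier (M'' , _ , (earlier , u , u∈S , u∉S'') , M''≤exits) =
          exchange-not-lighter exits⊆M M''≤exits R⊆ Q⊆
            (+-mono-<-≤ (p⊂q⇒∣p∣<∣q∣ (R⊆ , u , R-closed u∈S (∈R⁺ here) , u∉R')) (p⊆q⇒∣p∣≤∣q∣ Q⊆))
          where
            R⊆ : R ((M ─ exits) ∪ M'') ⊆ R M
            R⊆ w∈R = R-closed (earlier _ (Reach-swapped-in (∈R⁻ w∈R))) (∈R⁺ here)
            u∉R' : u ∉ R ((M ─ exits) ∪ M'')
            u∉R' u∈R = u∉S'' (Reach-swapped-in (∈R⁻ u∈R))
            Q⊆ : Q ((M ─ exits) ∪ M'') ⊆ Q M
            Q⊆ w∈Q = ∈Q⁺ (Reach-swapped-elsewhere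
                             (λ a∈A₂ a∈exits → A₁∌A₂ (exits⊆A₁ a∈exits) a∈A₂) (∈Q⁻ w∈Q))

    entry? : Decidable (λ a → a ∈ A₂ × src G a ∉ Q M × tgt G a ∈ Q M)
    entry? a = a ∈? A₂ ×-dec (¬? (src G a ∈? Q M) ×-dec tgt G a ∈? Q M)

    entries : ArcSet G
    entries = ⟦ entry? ⟧

    entries⊆A₂ : entries ⊆ A₂
    entries⊆A₂ a∈entries = proj₁ (∈⟦⟧⁻ entry? a∈entries)

    entries⊆M : entries ⊆ M
    entries⊆M {a} a∈entries with ∈⟦⟧⁻ entry? a∈entries
    ... | a∈A₂ , src∉Q , tgt∈Q = decidable-stable (a ∈? M)
      (λ a∉M → src∉Q (∈Q⁺ (step a a∈A₂ a∉M (∈Q⁻ tgt∈Q))))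

    Q-closed : ∀ {x y} → Reach G A₂ entries x y → y ∈ Q M → x ∈ Q M
    Q-closed here                       y∈Q = y∈Q
    Q-closed (step a a∈A₂ a∉entries r) y∈Q = decidable-stable (src G a ∈? Q M)
      (λ src∉Q → a∉entries (∈⟦⟧⁺ entry? (a∈A₂ , src∉Q , Q-closed r y∈Q)))

    entries-latest : ∀ v → v ∉ Q M → Latest G A₂ v t entries
    entries-latest v v∉Q = (entries⊆A₂ , λ r → v∉Q (Q-closed r (∈Q⁺ here))) , no-later
      where
        no-later : ¬ ∃ λ M'' → Cut G A₂ v t M'' × StrictlyLater G A₂ v t M'' entries ×
                               ∣ M'' ∣ ≤ ∣ entries ∣
        no-later (M'' , _ , (later , u , u∈T , u∉T'') , M''≤entries) =
          exchange-not-lighter entries⊆M M''≤entries R⊆ Q⊆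
            (+-mono-≤-< (p⊆q⇒∣p∣≤∣q∣ R⊆) (p⊂q⇒∣p∣<∣q∣ (Q⊆ , u , Q-closed u∈T (∈Q⁺ here) , u∉Q')))
          where
            Q⊆ : Q ((M ─ entries) ∪ M'') ⊆ Q M
            Q⊆ w∈Q = Q-closed (later _ (Reach-swapped-in (∈Q⁻ w∈Q))) (∈Q⁺ here)
            u∉Q' : u ∉ Q ((M ─ entries) ∪ M'')
            u∉Q' u∈Q = u∉T'' (Reach-swapped-in (∈Q⁻ u∈Q))
            R⊆ : R ((M ─ entries) ∪ M'') ⊆ R M
            R⊆ w∈R = ∈R⁺ (Reach-swapped-elsewhere
                             (λ a∈A₁ a∈entries → A₁∌A₂ a∈A₁ (entries⊆A₂ a∈entries)) (∈R⁻ w∈R))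

    lightest⇒split-covering : SplitCovering G A₁ A₂ s t M
    lightest⇒split-covering v with v ∈? R M
    ... | no  v∉R = exits   , exits⊆M   , inj₂ (inj₁ (exits-earliest v v∉R))
    ... | yes v∈R = entries , entries⊆M , inj₂ (inj₂ (entries-latest v (cut⇒R∌Q cut v∈R)))

theorem17 : (G : MultiDigraph) (A₁ A₂ : ArcSet G) (s t : Vtx G) →
    s ≢ t → ArcSplit G A₁ A₂ →
    (∀ M → SplitCovering G A₁ A₂ s t M → Cut G ⊤ s t M) ×
    (∃ λ M → MinCut G ⊤ s t M × SplitCovering G A₁ A₂ s t M)
theorem17 G A₁ A₂ s t s≢t split with lightest-min-cut G A₁ A₂ s t split s≢t
... | M , min-cut , lightest =
  split-covering⇒cut G A₁ A₂ s t split ,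
  (M , min-cut , lightest⇒split-covering G A₁ A₂ s t split (proj₁ min-cut) lightest)
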